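{- For every term M : NAT→NAT of T^{⊕}, there are terms F : NAT→NAT→BIN and Q : NAT→NAT of System T such that, for every natural number n, ⟦M n⟧ = { k ↦ NF(F n k) } and NF(F n k) = 0 for every k ≥ NF(Q n).
   Context: T^{⊕} is Gödel's System T (simply typed λ-calculus with natural numbers 0, S, pairs with projections, and a primitive recursor rec) extended with a binary probabilistic choice M ⊕ N that reduces to M or to N with probability 1/2 each, under weak call-by-value reduction lifted to distributions. ⟦P⟧ denotes the evaluation of P, i.e. the (limit) distribution over values it reduces to. BIN is the System T type of dyadic rationals m/2^n, encoded as pairs ⟨m,n⟩ of naturals, and NF(P) is the normal form of a deterministic System T term P. Here n and k are the numerals for n and k. The claim is that the distribution computed by M on each input is finitely supported, with probabilities and a support bound given by System T-definable functions of the input. -}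

module Defs where

open import Data.Nat using (ℕ; zero; suc; _≤_; _≟_)
open import Data.List using (List; []; _∷_; _++_; [_])
open import Data.Maybe using (Maybe; just; nothing)
import Data.Maybe as Maybe
open import Data.Product using (_×_; _,_; Σ; ∃; ∃-syntax)
open import Data.Unit using (⊤; tt)
open import Data.Empty using (⊥)
open import Data.Integer using (+_)
open import Data.Rational using (ℚ; _+_; _*_; _-_; ½; 0ℚ; 1ℚ; ∣_∣; _<_; _/_)
open import Relation.Nullary using (yes; no)
open import Relation.Binary.PropositionalEquality using (_≡_)

infixr 7 _⇒_
infixr 8 _⊗_

data Ty : Set where
  nat : Ty
  _⇒_ : Ty → Ty → Ty
  _⊗_ : Ty → Ty → Ty

-- BIN: dyadic rationals m/2^n encoded as pairs ⟨m , n⟩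
BIN : Ty
BIN = nat ⊗ nat

Ctx : Set
Ctx = List Ty

infix 4 _∋_
data _∋_ : Ctx → Ty → Set where
  here  : ∀ {Γ A} → (A ∷ Γ) ∋ A
  there : ∀ {Γ A B} → Γ ∋ A → (B ∷ Γ) ∋ A

infixl 6 _⊕_

data Tm (Γ : Ctx) : Ty → Set where
  var    : ∀ {A} → Γ ∋ A → Tm Γ A
  lam    : ∀ {A B} → Tm (A ∷ Γ) B → Tm Γ (A ⇒ B)
  app    : ∀ {A B} → Tm Γ (A ⇒ B) → Tm Γ A → Tm Γ B
  zeroₜ  : Tm Γ nat
  sucₜ   : Tm Γ nat → Tm Γ nat
  pair   : ∀ {A B} → Tm Γ A → Tm Γ B → Tm Γ (A ⊗ B)
  fst    : ∀ {A B} → Tm Γ (A ⊗ B) → Tm Γ A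
  snd    : ∀ {A B} → Tm Γ (A ⊗ B) → Tm Γ B
  rec    : ∀ {A} → Tm Γ A → Tm Γ (nat ⇒ A ⇒ A) → Tm Γ nat → Tm Γ A
  _⊕_    : ∀ {A} → Tm Γ A → Tm Γ A → Tm Γ A

-- System T terms: those with no occurrence of ⊕
Det : ∀ {Γ A} → Tm Γ A → Set
Det (var x)     = ⊤
Det (lam M)     = Det M
Det (app M N)   = Det M × Det N
Det zeroₜ       = ⊤
Det (sucₜ M)    = Det M
Det (pair M N)  = Det M × Det N
Det (fst M)     = Det M
Det (snd M)     = Det M
Det (rec M N P) = Det M × Det N × Det P
Det (M ⊕ N)     = ⊥

num : ∀ {Γ} → ℕ → Tm Γ nat
num zero    = zeroₜ
num (suc n) = sucₜ (num n)

Ren : Ctx → Ctx → Set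
Ren Γ Δ = ∀ {A} → Γ ∋ A → Δ ∋ A

ext : ∀ {Γ Δ B} → Ren Γ Δ → Ren (B ∷ Γ) (B ∷ Δ)
ext ρ here      = here
ext ρ (there x) = there (ρ x)

rename : ∀ {Γ Δ A} → Ren Γ Δ → Tm Γ A → Tm Δ A
rename ρ (var x)     = var (ρ x)
rename ρ (lam M)     = lam (rename (ext ρ) M)
rename ρ (app M N)   = app (rename ρ M) (rename ρ N)
rename ρ zeroₜ       = zeroₜ
rename ρ (sucₜ M)    = sucₜ (rename ρ M)
rename ρ (pair M N)  = pair (rename ρ M) (rename ρ N)
rename ρ (fst M)     = fst (rename ρ M)
rename ρ (snd M)     = snd (rename ρ M)
rename ρ (rec M N P) = rec (rename ρ M) (rename ρ N) (rename ρ P)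
rename ρ (M ⊕ N)     = rename ρ M ⊕ rename ρ N

Sub : Ctx → Ctx → Set
Sub Γ Δ = ∀ {A} → Γ ∋ A → Tm Δ A

exts : ∀ {Γ Δ B} → Sub Γ Δ → Sub (B ∷ Γ) (B ∷ Δ)
exts σ here      = var here
exts σ (there x) = rename there (σ x)

subst : ∀ {Γ Δ A} → Sub Γ Δ → Tm Γ A → Tm Δ A
subst σ (var x)     = σ x
subst σ (lam M)     = lam (subst (exts σ) M)
subst σ (app M N)   = app (subst σ M) (subst σ N)
subst σ zeroₜ       = zeroₜ
subst σ (sucₜ M)    = sucₜ (subst σ M)
subst σ (pair M N)  = pair (subst σ M) (subst σ N)
subst σ (fst M)     = fst (subst σ M)
subst σ (snd M)     = snd (subst σ M)
subst σ (rec M N P) = rec (subst σ M) (subst σ N) (subst σ P)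
subst σ (M ⊕ N)     = subst σ M ⊕ subst σ N

subst1 : ∀ {Γ A B} → Tm (B ∷ Γ) A → Tm Γ B → Tm Γ A
subst1 {Γ} {A} {B} M V = subst σ M
  where
  σ : Sub (B ∷ Γ) Γ
  σ here      = V
  σ (there x) = var x

data IsVal {Γ : Ctx} : ∀ {A} → Tm Γ A → Set where
  vlam  : ∀ {A B} {M : Tm (A ∷ Γ) B} → IsVal (lam M)
  vzero : IsVal zeroₜ
  vsuc  : ∀ {M : Tm Γ nat} → IsVal M → IsVal (sucₜ M)
  vpair : ∀ {A B} {M : Tm Γ A} {N : Tm Γ B} → IsVal M → IsVal N → IsVal (pair M N)

-- One step of weak call-by-value reduction (left-to-right) of a closed
-- term: either it is a value, or it reduces deterministically, or it
-- reduces to each of two terms with probability 1/2 (a ⊕ redex).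

data Step {A} (M : Tm [] A) : Set where
  done : IsVal M → Step M
  go   : Tm [] A → Step M
  flip : Tm [] A → Tm [] A → Step M

betaV : ∀ {A B} {M : Tm [] (A ⇒ B)} → IsVal M → Tm [] A → Tm [] B
betaV (vlam {M = b}) V = subst1 b V

fstV : ∀ {A B} {M : Tm [] (A ⊗ B)} → IsVal M → Tm [] A
fstV (vpair {M = V} _ _) = V

sndV : ∀ {A B} {M : Tm [] (A ⊗ B)} → IsVal M → Tm [] B
sndV (vpair {N = W} _ _) = W

recV : ∀ {A} {P : Tm [] nat} → Tm [] A → Tm [] (nat ⇒ A ⇒ A) → IsVal P → Tm [] A
recV V W vzero            = V
recV V W (vsuc {M = U} _) = app (app W U) (rec V W U)

step : ∀ {A} (M : Tm [] A) → Step M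
step (var ())
step (lam M) = done vlam
step zeroₜ = done vzero
step (sucₜ M) with step M
... | done v   = done (vsuc v)
... | go M'    = go (sucₜ M')
... | flip a b = flip (sucₜ a) (sucₜ b)
step (pair M N) with step M
... | go M'    = go (pair M' N)
... | flip a b = flip (pair a N) (pair b N)
... | done v with step N
...   | done w   = done (vpair v w)
...   | go N'    = go (pair M N')
...   | flip a b = flip (pair M a) (pair M b)
step (app M N) with step M
... | go M'    = go (app M' N)
... | flip a b = flip (app a N) (app b N)
... | done v with step N
...   | done w   = go (betaV v N)
...   | go N'    = go (app M N')
...   | flip a b = flip (app M a) (app M b)
step (fst M) with step M
... | done v   = go (fstV v)
... | go M'    = go (fst M')
... | flip a b = flip (fst a) (fst b)
step (snd M) with step M
... | done v   = go (sndV v)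
... | go M'    = go (snd M')
... | flip a b = flip (snd a) (snd b)
step (rec M N P) with step M
... | go M'    = go (rec M' N P)
... | flip a b = flip (rec a N P) (rec b N P)
... | done _ with step N
...   | go N'    = go (rec M N' P)
...   | flip a b = flip (rec M a P) (rec M b P)
...   | done _ with step P
...     | done u   = go (recV M N u)
...     | go P'    = go (rec M N P')
...     | flip a b = flip (rec M N a) (rec M N b)
step (M ⊕ N) = flip M N

Dist : Ty → Set
Dist A = List (ℚ × Tm [] A)

stepD : ∀ {A} → Dist A → Dist A
stepD [] = []
stepD ((p , M) ∷ D) with step M
... | done _   = (p , M) ∷ stepD D
... | go M'    = (p , M') ∷ stepD D
... | flip a b = (p * ½ , a) ∷ (p * ½ , b) ∷ stepD D

iterD : ∀ {A} → ℕ → Tm [] A → Dist A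
iterD zero    P = [ (1ℚ , P) ]
iterD (suc i) P = stepD (iterD i P)

isNum : ∀ {Γ} → Tm Γ nat → Maybe ℕ
isNum zeroₜ    = just zero
isNum (sucₜ M) = Maybe.map suc (isNum M)
isNum _        = nothing

massAt : ℕ → Dist nat → ℚ
massAt k [] = 0ℚ
massAt k ((p , M) ∷ D) with isNum M
... | nothing = massAt k D
... | just j with j ≟ k
...   | yes _ = p + massAt k D
...   | no _  = massAt k D

_⟶_ : (ℕ → ℚ) → ℚ → Set
s ⟶ q = ∀ (ε : ℚ) → 0ℚ < ε → ∃[ N ] (∀ i → N ≤ i → ∣ s i - q ∣ < ε)

⟦_⟧at_≡_ : Tm [] nat → ℕ → ℚ → Set
⟦ P ⟧at k ≡ q = (λ i → massAt k (iterD i P)) ⟶ q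

data _⟶*_ {A} : Tm [] A → Tm [] A → Set where
  stop : ∀ {M} → M ⟶* M
  more : ∀ {M M' N} → step M ≡ go M' → M' ⟶* N → M ⟶* N

NF_≡_ : ∀ {A} → Tm [] A → Tm [] A → Set
NF P ≡ V = (P ⟶* V) × IsVal V

dyadic : ℕ → ℕ → ℚ
dyadic m zero    = + m / 1
dyadic m (suc e) = ½ * dyadic m e

-- Interpret T⊕ in the monad of finite binary trees, a node being a fair coin flip. A logical
-- relation closed under the reduction rules shows that the reduction of M n follows the tree of
-- M at n, so ⟦M n⟧ gives k the mass of the leaves labelled k. A monadic translation into System T
-- represents a tree by a depth d and a function from coin sequences s < 2^d to results; the mass
-- of k is then #{s < 2^d | result k} / 2^d, which vanishes for k > Σ_{s < 2^d} result(s), and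
-- both quantities are System T programs in n and k. The same logical relation, for the identity
-- monad and ⊕-free terms, computes the normal forms of these programs.

module Submission where

open import Defs
open import Data.Empty using (⊥; ⊥-elim)
open import Data.Unit using (⊤; tt)
open import Data.List using ([]; _∷_; _++_; [_]; map)
open import Data.Maybe using (just; nothing)
open import Data.Nat as ℕ using (ℕ; zero; suc; _+_; _^_; _≤_; _⊔_; s≤s; _≟_)
import Data.Nat.Properties as ℕ
open import Data.Nat.GeneralisedArithmetic using (fold; iterate; iterate-is-fold)
open import Data.Integer as ℤ using (+_)
import Data.Integer.Properties as ℤ
open import Data.Rational using (ℚ; ½; 0ℚ; 1ℚ; _/_; _-_; _<_; ∣_∣; toℚᵘ) renaming (_+_ to _+ℚ_; _*_ to _*ℚ_)
import Data.Rational.Properties as ℚ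
import Data.Rational.Unnormalised as ℚᵘ
import Data.Rational.Unnormalised.Properties as ℚᵘₚ
open import Data.Product using (Σ; ∃-syntax; _×_; _,_; proj₁; proj₂)
open import Relation.Nullary using (yes; no; ¬_)
open import Relation.Binary.PropositionalEquality
  using (_≡_; refl; sym; trans; cong; cong₂; module ≡-Reasoning)
import Relation.Binary.PropositionalEquality as Eq

fromℕ-+ : ∀ a b → + (a + b) / 1 ≡ + a / 1 +ℚ + b / 1
fromℕ-+ a b = ℚ.toℚᵘ-injective (ℚᵘₚ.≃-sym (begin-equality
    toℚᵘ (+ a / 1 +ℚ + b / 1)               ≃⟨ ℚ.toℚᵘ-homo-+ (+ a / 1) (+ b / 1) ⟩
    toℚᵘ (+ a / 1) ℚᵘ.+ toℚᵘ (+ b / 1)      ≃⟨ ℚᵘₚ.+-cong (ℚ.toℚᵘ-fromℚᵘ a/1) (ℚ.toℚᵘ-fromℚᵘ b/1) ⟩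
    a/1 ℚᵘ.+ b/1                             ≃⟨ ℚᵘ.*≡* sum-over-1 ⟩
    a+b/1                                    ≃⟨ ℚᵘₚ.≃-sym (ℚ.toℚᵘ-fromℚᵘ a+b/1) ⟩
    toℚᵘ (+ (a + b) / 1)                     ∎))
  where
  open ℚᵘₚ.≤-Reasoning
  a/1 b/1 a+b/1 : ℚᵘ.ℚᵘ
  a/1 = ℚᵘ.mkℚᵘ (+ a) 0
  b/1 = ℚᵘ.mkℚᵘ (+ b) 0
  a+b/1 = ℚᵘ.mkℚᵘ (+ (a + b)) 0
  sum-over-1 : (+ a ℤ.* + 1 ℤ.+ + b ℤ.* + 1) ℤ.* + 1 ≡ + (a + b) ℤ.* + 1
  sum-over-1 = trans (ℤ.*-identityʳ _)
    (trans (cong₂ ℤ._+_ (ℤ.*-identityʳ (+ a)) (ℤ.*-identityʳ (+ b))) (sym (ℤ.*-identityʳ _)))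

dyadic-+ : ∀ a b e → dyadic (a + b) e ≡ dyadic a e +ℚ dyadic b e
dyadic-+ a b zero    = fromℕ-+ a b
dyadic-+ a b (suc e) = trans (cong (½ *ℚ_) (dyadic-+ a b e)) (ℚ.*-distribˡ-+ ½ (dyadic a e) (dyadic b e))

dyadic-zero : ∀ e → dyadic 0 e ≡ 0ℚ
dyadic-zero zero    = refl
dyadic-zero (suc e) = trans (cong (½ *ℚ_) (dyadic-zero e)) (ℚ.*-zeroʳ ½)

dyadic-2^ : ∀ e → dyadic (2 ^ e) e ≡ 1ℚ
dyadic-2^ zero    = refl
dyadic-2^ (suc e) = begin
  ½ *ℚ dyadic (2 ^ e + (2 ^ e + 0)) e       ≡⟨ cong (λ x → ½ *ℚ dyadic (2 ^ e + x) e) (ℕ.+-identityʳ (2 ^ e)) ⟩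
  ½ *ℚ dyadic (2 ^ e + 2 ^ e) e             ≡⟨ cong (½ *ℚ_) (dyadic-+ (2 ^ e) (2 ^ e) e) ⟩
  ½ *ℚ (dyadic (2 ^ e) e +ℚ dyadic (2 ^ e) e) ≡⟨ cong (λ x → ½ *ℚ (x +ℚ x)) (dyadic-2^ e) ⟩
  ½ *ℚ (1ℚ +ℚ 1ℚ)                           ≡⟨⟩
  1ℚ                                         ∎
  where open ≡-Reasoning

_≗ʳ_ : ∀ {Γ Δ} → Ren Γ Δ → Ren Γ Δ → Set
ρ ≗ʳ ρ′ = ∀ {A} (x : _ ∋ A) → ρ x ≡ ρ′ x

_≗ˢ_ : ∀ {Γ Δ} → Sub Γ Δ → Sub Γ Δ → Set
σ ≗ˢ σ′ = ∀ {A} (x : _ ∋ A) → σ x ≡ σ′ x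

ext-cong : ∀ {Γ Δ B} {ρ ρ′ : Ren Γ Δ} → ρ ≗ʳ ρ′ → ext {B = B} ρ ≗ʳ ext ρ′
ext-cong e here      = refl
ext-cong e (there x) = cong there (e x)

rename-cong : ∀ {Γ Δ A} {ρ ρ′ : Ren Γ Δ} → ρ ≗ʳ ρ′ → (M : Tm Γ A) → rename ρ M ≡ rename ρ′ M
rename-cong e (var x)     = cong var (e x)
rename-cong e (lam M)     = cong lam (rename-cong (ext-cong e) M)
rename-cong e (app M N)   = cong₂ app (rename-cong e M) (rename-cong e N)
rename-cong e zeroₜ       = refl
rename-cong e (sucₜ M)    = cong sucₜ (rename-cong e M)
rename-cong e (pair M N)  = cong₂ pair (rename-cong e M) (rename-cong e N)
rename-cong e (fst M)     = cong fst (rename-cong e M)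
rename-cong e (snd M)     = cong snd (rename-cong e M)
rename-cong e (rec M N P) rewrite rename-cong e M | rename-cong e N | rename-cong e P = refl
rename-cong e (M ⊕ N)     = cong₂ _⊕_ (rename-cong e M) (rename-cong e N)

exts-cong : ∀ {Γ Δ B} {σ σ′ : Sub Γ Δ} → σ ≗ˢ σ′ → exts {B = B} σ ≗ˢ exts σ′
exts-cong e here      = refl
exts-cong e (there x) = cong (rename there) (e x)

subst-cong : ∀ {Γ Δ A} {σ σ′ : Sub Γ Δ} → σ ≗ˢ σ′ → (M : Tm Γ A) → subst σ M ≡ subst σ′ M
subst-cong e (var x)     = e x
subst-cong e (lam M)     = cong lam (subst-cong (exts-cong e) M)
subst-cong e (app M N)   = cong₂ app (subst-cong e M) (subst-cong e N)
subst-cong e zeroₜ       = refl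
subst-cong e (sucₜ M)    = cong sucₜ (subst-cong e M)
subst-cong e (pair M N)  = cong₂ pair (subst-cong e M) (subst-cong e N)
subst-cong e (fst M)     = cong fst (subst-cong e M)
subst-cong e (snd M)     = cong snd (subst-cong e M)
subst-cong e (rec M N P) rewrite subst-cong e M | subst-cong e N | subst-cong e P = refl
subst-cong e (M ⊕ N)     = cong₂ _⊕_ (subst-cong e M) (subst-cong e N)

rename-rename : ∀ {Γ Δ Θ A} (ρ : Ren Δ Θ) (ρ′ : Ren Γ Δ) (M : Tm Γ A) →
  rename ρ (rename ρ′ M) ≡ rename (λ x → ρ (ρ′ x)) M
rename-rename ρ ρ′ (var x)     = refl
rename-rename ρ ρ′ (lam M)     = cong lam (trans (rename-rename (ext ρ) (ext ρ′) M)
  (rename-cong (λ { here → refl ; (there x) → refl }) M))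
rename-rename ρ ρ′ (app M N)   = cong₂ app (rename-rename ρ ρ′ M) (rename-rename ρ ρ′ N)
rename-rename ρ ρ′ zeroₜ       = refl
rename-rename ρ ρ′ (sucₜ M)    = cong sucₜ (rename-rename ρ ρ′ M)
rename-rename ρ ρ′ (pair M N)  = cong₂ pair (rename-rename ρ ρ′ M) (rename-rename ρ ρ′ N)
rename-rename ρ ρ′ (fst M)     = cong fst (rename-rename ρ ρ′ M)
rename-rename ρ ρ′ (snd M)     = cong snd (rename-rename ρ ρ′ M)
rename-rename ρ ρ′ (rec M N P)
  rewrite rename-rename ρ ρ′ M | rename-rename ρ ρ′ N | rename-rename ρ ρ′ P = refl
rename-rename ρ ρ′ (M ⊕ N)     = cong₂ _⊕_ (rename-rename ρ ρ′ M) (rename-rename ρ ρ′ N)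

subst-rename : ∀ {Γ Δ Θ A} (σ : Sub Δ Θ) (ρ : Ren Γ Δ) (M : Tm Γ A) →
  subst σ (rename ρ M) ≡ subst (λ x → σ (ρ x)) M
subst-rename σ ρ (var x)     = refl
subst-rename σ ρ (lam M)     = cong lam (trans (subst-rename (exts σ) (ext ρ) M)
  (subst-cong (λ { here → refl ; (there x) → refl }) M))
subst-rename σ ρ (app M N)   = cong₂ app (subst-rename σ ρ M) (subst-rename σ ρ N)
subst-rename σ ρ zeroₜ       = refl
subst-rename σ ρ (sucₜ M)    = cong sucₜ (subst-rename σ ρ M)
subst-rename σ ρ (pair M N)  = cong₂ pair (subst-rename σ ρ M) (subst-rename σ ρ N)
subst-rename σ ρ (fst M)     = cong fst (subst-rename σ ρ M)
subst-rename σ ρ (snd M)     = cong snd (subst-rename σ ρ M)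
subst-rename σ ρ (rec M N P)
  rewrite subst-rename σ ρ M | subst-rename σ ρ N | subst-rename σ ρ P = refl
subst-rename σ ρ (M ⊕ N)     = cong₂ _⊕_ (subst-rename σ ρ M) (subst-rename σ ρ N)

rename-subst : ∀ {Γ Δ Θ A} (ρ : Ren Δ Θ) (σ : Sub Γ Δ) (M : Tm Γ A) →
  rename ρ (subst σ M) ≡ subst (λ x → rename ρ (σ x)) M
rename-subst ρ σ (var x)     = refl
rename-subst ρ σ (lam M)     = cong lam (trans (rename-subst (ext ρ) (exts σ) M)
  (subst-cong (λ { here → refl
                 ; (there x) → trans (rename-rename (ext ρ) there (σ x)) (sym (rename-rename there ρ (σ x))) }) M))
rename-subst ρ σ (app M N)   = cong₂ app (rename-subst ρ σ M) (rename-subst ρ σ N)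
rename-subst ρ σ zeroₜ       = refl
rename-subst ρ σ (sucₜ M)    = cong sucₜ (rename-subst ρ σ M)
rename-subst ρ σ (pair M N)  = cong₂ pair (rename-subst ρ σ M) (rename-subst ρ σ N)
rename-subst ρ σ (fst M)     = cong fst (rename-subst ρ σ M)
rename-subst ρ σ (snd M)     = cong snd (rename-subst ρ σ M)
rename-subst ρ σ (rec M N P)
  rewrite rename-subst ρ σ M | rename-subst ρ σ N | rename-subst ρ σ P = refl
rename-subst ρ σ (M ⊕ N)     = cong₂ _⊕_ (rename-subst ρ σ M) (rename-subst ρ σ N)

subst-subst : ∀ {Γ Δ Θ A} (σ : Sub Δ Θ) (τ : Sub Γ Δ) (M : Tm Γ A) →
  subst σ (subst τ M) ≡ subst (λ x → subst σ (τ x)) M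
subst-subst σ τ (var x)     = refl
subst-subst σ τ (lam M)     = cong lam (trans (subst-subst (exts σ) (exts τ) M)
  (subst-cong (λ { here → refl
                 ; (there x) → trans (subst-rename (exts σ) there (τ x)) (sym (rename-subst there σ (τ x))) }) M))
subst-subst σ τ (app M N)   = cong₂ app (subst-subst σ τ M) (subst-subst σ τ N)
subst-subst σ τ zeroₜ       = refl
subst-subst σ τ (sucₜ M)    = cong sucₜ (subst-subst σ τ M)
subst-subst σ τ (pair M N)  = cong₂ pair (subst-subst σ τ M) (subst-subst σ τ N)
subst-subst σ τ (fst M)     = cong fst (subst-subst σ τ M)
subst-subst σ τ (snd M)     = cong snd (subst-subst σ τ M)
subst-subst σ τ (rec M N P)
  rewrite subst-subst σ τ M | subst-subst σ τ N | subst-subst σ τ P = refl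
subst-subst σ τ (M ⊕ N)     = cong₂ _⊕_ (subst-subst σ τ M) (subst-subst σ τ N)

subst-var : ∀ {Γ A} {σ : Sub Γ Γ} → σ ≗ˢ var → (M : Tm Γ A) → subst σ M ≡ M
subst-var e (var x)     = e x
subst-var e (lam M)     = cong lam (subst-var (λ { here → refl ; (there x) → cong (rename there) (e x) }) M)
subst-var e (app M N)   = cong₂ app (subst-var e M) (subst-var e N)
subst-var e zeroₜ       = refl
subst-var e (sucₜ M)    = cong sucₜ (subst-var e M)
subst-var e (pair M N)  = cong₂ pair (subst-var e M) (subst-var e N)
subst-var e (fst M)     = cong fst (subst-var e M)
subst-var e (snd M)     = cong snd (subst-var e M)
subst-var e (rec M N P) rewrite subst-var e M | subst-var e N | subst-var e P = refl
subst-var e (M ⊕ N)     = cong₂ _⊕_ (subst-var e M) (subst-var e N)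

subst-closed : ∀ {A} (σ : Sub [] []) (M : Tm [] A) → subst σ M ≡ M
subst-closed σ = subst-var (λ ())

_,ₛ_ : ∀ {Γ B} → Sub Γ [] → Tm [] B → Sub (B ∷ Γ) []
(σ ,ₛ V) here      = V
(σ ,ₛ V) (there x) = σ x

subst1-exts : ∀ {Γ A B} (σ : Sub Γ []) (M : Tm (B ∷ Γ) A) (V : Tm [] B) →
  subst1 (subst (exts σ) M) V ≡ subst (σ ,ₛ V) M
subst1-exts σ M V = trans (subst-subst _ (exts σ) M) (subst-cong (λ
  { here      → refl
  ; (there x) → trans (subst-rename _ there (σ x)) (subst-closed _ (σ x)) }) M)

step-value : ∀ {A} {V : Tm [] A} → IsVal V → Σ (IsVal V) λ v → step V ≡ done v
step-value vlam  = vlam , refl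
step-value vzero = vzero , refl
step-value (vsuc v) with step-value v
... | w , e rewrite e = vsuc w , refl
step-value (vpair v₁ v₂) with step-value v₁ | step-value v₂
... | w₁ , e₁ | w₂ , e₂ rewrite e₁ | e₂ = vpair w₁ w₂ , refl

num-value : ∀ n → IsVal {[]} (num n)
num-value zero    = vzero
num-value (suc n) = vsuc (num-value n)

data Frame : Ty → Ty → Set where
  sucₖ  : Frame nat nat
  pairˡ : ∀ {A B} → Tm [] B → Frame A (A ⊗ B)
  pairʳ : ∀ {A B} {V : Tm [] A} → IsVal V → Frame B (A ⊗ B)
  appˡ  : ∀ {A B} → Tm [] A → Frame (A ⇒ B) B
  appʳ  : ∀ {A B} {V : Tm [] (A ⇒ B)} → IsVal V → Frame A B
  fstₖ  : ∀ {A B} → Frame (A ⊗ B) A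
  sndₖ  : ∀ {A B} → Frame (A ⊗ B) B
  rec₁  : ∀ {A} → Tm [] (nat ⇒ A ⇒ A) → Tm [] nat → Frame A A
  rec₂  : ∀ {A} {V : Tm [] A} → IsVal V → Tm [] nat → Frame (nat ⇒ A ⇒ A) A
  rec₃  : ∀ {A} {V : Tm [] A} {W : Tm [] (nat ⇒ A ⇒ A)} → IsVal V → IsVal W → Frame nat A

plug : ∀ {A B} → Frame A B → Tm [] A → Tm [] B
plug sucₖ                   M = sucₜ M
plug (pairˡ N)              M = pair M N
plug (pairʳ {V = V} _)      M = pair V M
plug (appˡ N)               M = app M N
plug (appʳ {V = V} _)       M = app V M
plug fstₖ                   M = fst M
plug sndₖ                   M = snd M
plug (rec₁ N P)             M = rec M N P
plug (rec₂ {V = V} _ P)     M = rec V M P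
plug (rec₃ {V = V} {W} _ _) M = rec V W M

plug-go : ∀ {A B} (K : Frame A B) {M M′} → step M ≡ go M′ → step (plug K M) ≡ go (plug K M′)
plug-go sucₖ        e rewrite e = refl
plug-go (pairˡ N)   e rewrite e = refl
plug-go (pairʳ v)   e rewrite proj₂ (step-value v) | e = refl
plug-go (appˡ N)    e rewrite e = refl
plug-go (appʳ v)    e rewrite proj₂ (step-value v) | e = refl
plug-go fstₖ        e rewrite e = refl
plug-go sndₖ        e rewrite e = refl
plug-go (rec₁ N P)  e rewrite e = refl
plug-go (rec₂ v P)  e rewrite proj₂ (step-value v) | e = refl
plug-go (rec₃ v w)  e rewrite proj₂ (step-value v) | proj₂ (step-value w) | e = refl

plug-flip : ∀ {A B} (K : Frame A B) {M M₁ M₂} → step M ≡ flip M₁ M₂ →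
  step (plug K M) ≡ flip (plug K M₁) (plug K M₂)
plug-flip sucₖ        e rewrite e = refl
plug-flip (pairˡ N)   e rewrite e = refl
plug-flip (pairʳ v)   e rewrite proj₂ (step-value v) | e = refl
plug-flip (appˡ N)    e rewrite e = refl
plug-flip (appʳ v)    e rewrite proj₂ (step-value v) | e = refl
plug-flip fstₖ        e rewrite e = refl
plug-flip sndₖ        e rewrite e = refl
plug-flip (rec₁ N P)  e rewrite e = refl
plug-flip (rec₂ v P)  e rewrite proj₂ (step-value v) | e = refl
plug-flip (rec₃ v w)  e rewrite proj₂ (step-value v) | proj₂ (step-value w) | e = refl

step-β : ∀ {A B} (M : Tm (A ∷ []) B) {V : Tm [] A} → IsVal V → step (app (lam M) V) ≡ go (subst1 M V)
step-β M v rewrite proj₂ (step-value v) = refl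

step-fst : ∀ {A B} {V₁ : Tm [] A} {V₂ : Tm [] B} → IsVal V₁ → IsVal V₂ → step (fst (pair V₁ V₂)) ≡ go V₁
step-fst v₁ v₂ with step-value (vpair v₁ v₂)
... | vpair _ _ , e rewrite e = refl

step-snd : ∀ {A B} {V₁ : Tm [] A} {V₂ : Tm [] B} → IsVal V₁ → IsVal V₂ → step (snd (pair V₁ V₂)) ≡ go V₂
step-snd v₁ v₂ with step-value (vpair v₁ v₂)
... | vpair _ _ , e rewrite e = refl

step-rec-zero : ∀ {A} {V : Tm [] A} {W} → IsVal V → IsVal W → step (rec V W zeroₜ) ≡ go V
step-rec-zero v w rewrite proj₂ (step-value v) | proj₂ (step-value w) = refl

step-rec-suc : ∀ {A} {V : Tm [] A} {W U} → IsVal V → IsVal W → IsVal U →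
  step (rec V W (sucₜ U)) ≡ go (app (app W U) (rec V W U))
step-rec-suc v w u with step-value (vsuc u)
... | vsuc _ , e rewrite proj₂ (step-value v) | proj₂ (step-value w) | e = refl

⟶*-trans : ∀ {A} {M N L : Tm [] A} → M ⟶* N → N ⟶* L → M ⟶* L
⟶*-trans stop       r′ = r′
⟶*-trans (more e r) r′ = more e (⟶*-trans r r′)

plug-⟶* : ∀ {A B} (K : Frame A B) {M N} → M ⟶* N → plug K M ⟶* plug K N
plug-⟶* K stop       = stop
plug-⟶* K (more e r) = more (plug-go K e) (plug-⟶* K r)

-- Generalises Det (the case C = ⊥), so that one adequacy proof serves both effects below.
Admits : ∀ {Γ A} → Set → Tm Γ A → Set
Admits C (var x)     = ⊤
Admits C (lam M)     = Admits C M
Admits C (app M N)   = Admits C M × Admits C N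
Admits C zeroₜ       = ⊤
Admits C (sucₜ M)    = Admits C M
Admits C (pair M N)  = Admits C M × Admits C N
Admits C (fst M)     = Admits C M
Admits C (snd M)     = Admits C M
Admits C (rec M N P) = Admits C M × Admits C N × Admits C P
Admits C (M ⊕ N)     = C × Admits C M × Admits C N

Det⇒Admits : ∀ {Γ A C} (M : Tm Γ A) → Det M → Admits C M
Det⇒Admits (var x)     d              = tt
Det⇒Admits (lam M)     d              = Det⇒Admits M d
Det⇒Admits (app M N)   (d₁ , d₂)      = Det⇒Admits M d₁ , Det⇒Admits N d₂
Det⇒Admits zeroₜ       d              = tt
Det⇒Admits (sucₜ M)    d              = Det⇒Admits M d
Det⇒Admits (pair M N)  (d₁ , d₂)      = Det⇒Admits M d₁ , Det⇒Admits N d₂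
Det⇒Admits (fst M)     d              = Det⇒Admits M d
Det⇒Admits (snd M)     d              = Det⇒Admits M d
Det⇒Admits (rec M N P) (d₁ , d₂ , d₃) = Det⇒Admits M d₁ , Det⇒Admits N d₂ , Det⇒Admits P d₃

admits-⊤ : ∀ {Γ A} (M : Tm Γ A) → Admits ⊤ M
admits-⊤ (var x)     = tt
admits-⊤ (lam M)     = admits-⊤ M
admits-⊤ (app M N)   = admits-⊤ M , admits-⊤ N
admits-⊤ zeroₜ       = tt
admits-⊤ (sucₜ M)    = admits-⊤ M
admits-⊤ (pair M N)  = admits-⊤ M , admits-⊤ N
admits-⊤ (fst M)     = admits-⊤ M
admits-⊤ (snd M)     = admits-⊤ M
admits-⊤ (rec M N P) = admits-⊤ M , admits-⊤ N , admits-⊤ P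
admits-⊤ (M ⊕ N)     = tt , admits-⊤ M , admits-⊤ N

-- Runs P M c: the reduction of M carries out the computation c, ending in values related by P.
record Effect : Set₁ where
  field
    F      : Set → Set
    return : ∀ {X} → X → F X
    _>>=_  : ∀ {X Y} → F X → (X → F Y) → F Y
    choose : ∀ {X} → F X → F X → F X
    Runs   : ∀ {A X} → (Tm [] A → X → Set) → Tm [] A → F X → Set
    Choice : Set
    runs-return : ∀ {A X} {P : Tm [] A → X → Set} {V x} → P V x → Runs P V (return x)
    runs-go     : ∀ {A X} {P : Tm [] A → X → Set} {M M′ c} → step M ≡ go M′ → Runs P M′ c → Runs P M c
    runs-plug   : ∀ {A B X Y} {P : Tm [] A → X → Set} {Q : Tm [] B → Y → Set} (K : Frame A B)
                    {M c} {k : X → F Y} → Runs P M c → (∀ {V x} → P V x → Runs Q (plug K V) (k x)) →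
                    Runs Q (plug K M) (c >>= k)
    runs-⊕      : ∀ {A X} {P : Tm [] A → X → Set} {M N c₁ c₂} → Choice →
                    Runs P M c₁ → Runs P N c₂ → Runs P (M ⊕ N) (choose c₁ c₂)

module Adequacy (𝔼 : Effect) where
  open Effect 𝔼

  Sem : Ty → Set
  Sem nat     = ℕ
  Sem (A ⇒ B) = Sem A → F (Sem B)
  Sem (A ⊗ B) = Sem A × Sem B

  Env : Ctx → Set
  Env Γ = ∀ {A} → Γ ∋ A → Sem A

  ∅ᵉ : Env []
  ∅ᵉ ()

  _∷ᵉ_ : ∀ {Γ A} → Sem A → Env Γ → Env (A ∷ Γ)
  (v ∷ᵉ γ) here      = v
  (v ∷ᵉ γ) (there x) = γ x

  recSem : ∀ {X : Set} → X → (ℕ → F (X → F X)) → ℕ → F X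
  recSem z s zero    = return z
  recSem z s (suc n) = s n >>= λ g → recSem z s n >>= g

  eval : ∀ {Γ A} → Tm Γ A → Env Γ → F (Sem A)
  eval (var x)     γ = return (γ x)
  eval (lam M)     γ = return (λ v → eval M (v ∷ᵉ γ))
  eval (app M N)   γ = eval M γ >>= λ f → eval N γ >>= f
  eval zeroₜ       γ = return zero
  eval (sucₜ M)    γ = eval M γ >>= λ n → return (suc n)
  eval (pair M N)  γ = eval M γ >>= λ a → eval N γ >>= λ b → return (a , b)
  eval (fst M)     γ = eval M γ >>= λ p → return (proj₁ p)
  eval (snd M)     γ = eval M γ >>= λ p → return (proj₂ p)
  eval (rec M N P) γ = eval M γ >>= λ z → eval N γ >>= λ s → eval P γ >>= recSem z s
  eval (M ⊕ N)     γ = choose (eval M γ) (eval N γ)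

  _≈_ : ∀ {A} → Tm [] A → Sem A → Set
  _≈_ {nat}   V n = V ≡ num n
  _≈_ {A ⇒ B} V f = Σ (Tm (A ∷ []) B) λ M → V ≡ lam M × (∀ {W w} → W ≈ w → Runs _≈_ (subst1 M W) (f w))
  _≈_ {A ⊗ B} V p = Σ (Tm [] A) λ V₁ → Σ (Tm [] B) λ V₂ → V ≡ pair V₁ V₂ × V₁ ≈ proj₁ p × V₂ ≈ proj₂ p

  ≈-value : ∀ {A} {V : Tm [] A} {v} → V ≈ v → IsVal V
  ≈-value {nat} {v = n} refl             = num-value n
  ≈-value {A ⇒ B} (_ , refl , _)         = vlam
  ≈-value {A ⊗ B} (_ , _ , refl , r₁ , r₂) = vpair (≈-value r₁) (≈-value r₂)

  runs-app-value : ∀ {A B} {G : Tm [] (A ⇒ B)} {g W w} → G ≈ g → W ≈ w → Runs _≈_ (app G W) (g w)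
  runs-app-value (M , refl , rM) rW = runs-go (step-β M (≈-value rW)) (rM rW)

  runs-app : ∀ {A B} {G : Tm [] (A ⇒ B)} {g N c} → G ≈ g → Runs _≈_ N c → Runs _≈_ (app G N) (c >>= g)
  runs-app rG rN = runs-plug (appʳ (≈-value rG)) rN (runs-app-value rG)

  runs-rec : ∀ {A} {V : Tm [] A} {W z s} → V ≈ z → W ≈ s → ∀ n → Runs _≈_ (rec V W (num n)) (recSem z s n)
  runs-rec rV rW zero = runs-go (step-rec-zero (≈-value rV) (≈-value rW)) (runs-return rV)
  runs-rec {V = V} {W} rV rW (suc n) = runs-go (step-rec-suc (≈-value rV) (≈-value rW) (num-value n))
    (runs-plug (appˡ (rec V W (num n))) (runs-app-value rW refl) λ rG → runs-app rG (runs-rec rV rW n))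

  runs-fst : ∀ {A B} {V : Tm [] (A ⊗ B)} {p} → V ≈ p → Runs _≈_ (fst V) (return (proj₁ p))
  runs-fst (_ , _ , refl , r₁ , r₂) = runs-go (step-fst (≈-value r₁) (≈-value r₂)) (runs-return r₁)

  runs-snd : ∀ {A B} {V : Tm [] (A ⊗ B)} {p} → V ≈ p → Runs _≈_ (snd V) (return (proj₂ p))
  runs-snd (_ , _ , refl , r₁ , r₂) = runs-go (step-snd (≈-value r₁) (≈-value r₂)) (runs-return r₂)

  adequacy : ∀ {Γ A} (M : Tm Γ A) → Admits Choice M → (σ : Sub Γ []) (γ : Env Γ) →
    (∀ {B} (x : Γ ∋ B) → σ x ≈ γ x) → Runs _≈_ (subst σ M) (eval M γ)
  adequacy (var x) _ σ γ r = runs-return (r x)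
  adequacy (lam M) a σ γ r = runs-return (subst (exts σ) M , refl , λ {W} {w} rW →
    Eq.subst (λ T → Runs _≈_ T (eval M (w ∷ᵉ γ))) (sym (subst1-exts σ M W))
      (adequacy M a (σ ,ₛ W) (w ∷ᵉ γ) λ { here → rW ; (there x) → r x }))
  adequacy (app M N) (a₁ , a₂) σ γ r =
    runs-plug (appˡ (subst σ N)) (adequacy M a₁ σ γ r) λ rG → runs-app rG (adequacy N a₂ σ γ r)
  adequacy zeroₜ _ σ γ r = runs-return refl
  adequacy (sucₜ M) a σ γ r = runs-plug sucₖ (adequacy M a σ γ r) λ e → runs-return (cong sucₜ e)
  adequacy (pair M N) (a₁ , a₂) σ γ r =
    runs-plug (pairˡ (subst σ N)) (adequacy M a₁ σ γ r) λ r₁ →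
    runs-plug (pairʳ (≈-value r₁)) (adequacy N a₂ σ γ r) λ r₂ → runs-return (_ , _ , refl , r₁ , r₂)
  adequacy (fst M) a σ γ r = runs-plug fstₖ (adequacy M a σ γ r) runs-fst
  adequacy (snd M) a σ γ r = runs-plug sndₖ (adequacy M a σ γ r) runs-snd
  adequacy (rec M N P) (a₁ , a₂ , a₃) σ γ r =
    runs-plug (rec₁ (subst σ N) (subst σ P)) (adequacy M a₁ σ γ r) λ rV →
    runs-plug (rec₂ (≈-value rV) (subst σ P)) (adequacy N a₂ σ γ r) λ rW →
    runs-plug (rec₃ (≈-value rV) (≈-value rW)) (adequacy P a₃ σ γ r) λ { {x = n} refl → runs-rec rV rW n }
  adequacy (M ⊕ N) (c , a₁ , a₂) σ γ r = runs-⊕ c (adequacy M a₁ σ γ r) (adequacy N a₂ σ γ r)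

  adequacy-closed : ∀ {A} (M : Tm [] A) → Admits Choice M → Runs _≈_ M (eval M ∅ᵉ)
  adequacy-closed M a = Eq.subst (λ T → Runs _≈_ T (eval M ∅ᵉ)) (subst-closed _ M) (adequacy M a (λ ()) ∅ᵉ λ ())

data Tree (X : Set) : Set where
  leaf : X → Tree X
  node : Tree X → Tree X → Tree X

_>>=ᵗ_ : ∀ {X Y : Set} → Tree X → (X → Tree Y) → Tree Y
leaf x   >>=ᵗ k = k x
node t u >>=ᵗ k = node (t >>=ᵗ k) (u >>=ᵗ k)

data Follows {A X} (P : Tm [] A → X → Set) : Tm [] A → Tree X → Set where
  at-leaf  : ∀ {V x} → P V x → Follows P V (leaf x)
  via-go   : ∀ {M M′ t} → step M ≡ go M′ → Follows P M′ t → Follows P M t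
  via-flip : ∀ {M M₁ M₂ t₁ t₂} → step M ≡ flip M₁ M₂ →
             Follows P M₁ t₁ → Follows P M₂ t₂ → Follows P M (node t₁ t₂)

follows-plug : ∀ {A B X Y} {P : Tm [] A → X → Set} {Q : Tm [] B → Y → Set} (K : Frame A B) {M t} {k : X → Tree Y} →
  Follows P M t → (∀ {V x} → P V x → Follows Q (plug K V) (k x)) → Follows Q (plug K M) (t >>=ᵗ k)
follows-plug K (at-leaf p)        h = h p
follows-plug K (via-go e f)       h = via-go (plug-go K e) (follows-plug K f h)
follows-plug K (via-flip e f₁ f₂) h = via-flip (plug-flip K e) (follows-plug K f₁ h) (follows-plug K f₂ h)

treeEffect : Effect
treeEffect = record
  { F = Tree ; return = leaf ; _>>=_ = _>>=ᵗ_ ; choose = node ; Runs = Follows ; Choice = ⊤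
  ; runs-return = at-leaf ; runs-go = via-go ; runs-plug = follows-plug ; runs-⊕ = λ _ → via-flip refl }

Normalises : ∀ {A} {X : Set} → (Tm [] A → X → Set) → Tm [] A → X → Set
Normalises {A} P M x = Σ (Tm [] A) λ V → M ⟶* V × P V x

normalises-plug : ∀ {A B X Y} {P : Tm [] A → X → Set} {Q : Tm [] B → Y → Set} (K : Frame A B) {M x} {k : X → Y} →
  Normalises P M x → (∀ {V x} → P V x → Normalises Q (plug K V) (k x)) → Normalises Q (plug K M) (k x)
normalises-plug K (V , r , p) h with h p
... | V′ , r′ , q = V′ , ⟶*-trans (plug-⟶* K r) r′ , q

pureEffect : Effect
pureEffect = record
  { F = λ X → X ; return = λ x → x ; _>>=_ = λ x k → k x ; choose = λ x _ → x
  ; Runs = Normalises ; Choice = ⊥   -- so choose, a junk value, is never reached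
  ; runs-return = λ p → _ , stop , p
  ; runs-go = λ { e (V , r , p) → V , more e r , p }
  ; runs-plug = λ {Q = Q} K → normalises-plug {Q = Q} K ; runs-⊕ = λ () }

module Prob = Adequacy treeEffect
module Pure = Adequacy pureEffect

mass : ℕ → Tree ℕ → ℚ
mass k (leaf v) with v ≟ k
... | yes _ = 1ℚ
... | no _  = 0ℚ
mass k (node t u) = ½ *ℚ mass k t +ℚ ½ *ℚ mass k u

iterD≡iterate : ∀ {A} i (P : Tm [] A) → iterD i P ≡ iterate stepD [ (1ℚ , P) ] i
iterD≡iterate i P = trans (iterD≡fold i) (iterate-is-fold _ stepD i)
  where
  iterD≡fold : ∀ i → iterD i P ≡ fold [ (1ℚ , P) ] stepD i
  iterD≡fold zero    = refl
  iterD≡fold (suc i) = cong stepD (iterD≡fold i)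

stepD-++ : ∀ {A} (D₁ D₂ : Dist A) → stepD (D₁ ++ D₂) ≡ stepD D₁ ++ stepD D₂
stepD-++ [] D₂ = refl
stepD-++ ((p , M) ∷ D₁) D₂ with step M
... | done _   = cong ((p , M) ∷_) (stepD-++ D₁ D₂)
... | go M′    = cong ((p , M′) ∷_) (stepD-++ D₁ D₂)
... | flip a b = cong (λ D → (p *ℚ ½ , a) ∷ (p *ℚ ½ , b) ∷ D) (stepD-++ D₁ D₂)

iterate-stepD-++ : ∀ {A} i (D₁ D₂ : Dist A) →
  iterate stepD (D₁ ++ D₂) i ≡ iterate stepD D₁ i ++ iterate stepD D₂ i
iterate-stepD-++ zero    D₁ D₂ = refl
iterate-stepD-++ (suc i) D₁ D₂ rewrite stepD-++ D₁ D₂ = iterate-stepD-++ i (stepD D₁) (stepD D₂)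

iterate-stepD-value : ∀ {A} {V : Tm [] A} → IsVal V → ∀ i p → iterate stepD [ (p , V) ] i ≡ [ (p , V) ]
iterate-stepD-value v zero    p = refl
iterate-stepD-value v (suc i) p rewrite proj₂ (step-value v) = iterate-stepD-value v i p

massAt-++ : ∀ k (D₁ D₂ : Dist nat) → massAt k (D₁ ++ D₂) ≡ massAt k D₁ +ℚ massAt k D₂
massAt-++ k [] D₂ = sym (ℚ.+-identityˡ _)
massAt-++ k ((p , M) ∷ D₁) D₂ with isNum M
... | nothing = massAt-++ k D₁ D₂
... | just j with j ≟ k
...   | yes _ = trans (cong (p +ℚ_) (massAt-++ k D₁ D₂)) (sym (ℚ.+-assoc p _ _))
...   | no _  = massAt-++ k D₁ D₂

stepD-go : ∀ {A} {M M′ : Tm [] A} p → step M ≡ go M′ → stepD [ (p , M) ] ≡ [ (p , M′) ]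
stepD-go p e rewrite e = refl

stepD-flip : ∀ {A} {M M₁ M₂ : Tm [] A} p → step M ≡ flip M₁ M₂ →
  stepD [ (p , M) ] ≡ [ (p *ℚ ½ , M₁) ] ++ [ (p *ℚ ½ , M₂) ]
stepD-flip p e rewrite e = refl

isNum-num : ∀ v → isNum {[]} (num v) ≡ just v
isNum-num zero    = refl
isNum-num (suc v) rewrite isNum-num v = refl

massAt-num : ∀ k p v → massAt k [ (p , num v) ] ≡ p *ℚ mass k (leaf v)
massAt-num k p v rewrite isNum-num v with v ≟ k
... | yes _ = trans (ℚ.+-identityʳ p) (sym (ℚ.*-identityʳ p))
... | no _  = sym (ℚ.*-zeroʳ p)

massAt-follows : ∀ k {M : Tm [] nat} {t} → Follows Prob._≈_ M t → ∀ p →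
  ∃[ N ] (∀ i → N ≤ i → massAt k (iterate stepD [ (p , M) ] i) ≡ p *ℚ mass k t)
massAt-follows k (at-leaf {x = v} refl) p =
  0 , λ i _ → trans (cong (massAt k) (iterate-stepD-value (num-value v) i p)) (massAt-num k p v)
massAt-follows k (via-go e f) p with massAt-follows k f p
... | N , h = suc N , λ { (suc i) (s≤s N≤i) → Eq.subst (λ D → massAt k (iterate stepD D i) ≡ _)
                                                 (sym (stepD-go p e)) (h i N≤i) }
massAt-follows k (via-flip {M₁ = M₁} {M₂} {t₁} {t₂} e f₁ f₂) p
  with massAt-follows k f₁ (p *ℚ ½) | massAt-follows k f₂ (p *ℚ ½)
... | N₁ , h₁ | N₂ , h₂ = suc (N₁ ⊔ N₂) , λ { (suc i) (s≤s N≤i) → begin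
    massAt k (iterate stepD (stepD [ (p , _) ]) i)
      ≡⟨ cong (λ D → massAt k (iterate stepD D i)) (stepD-flip p e) ⟩
    massAt k (iterate stepD ([ (p *ℚ ½ , M₁) ] ++ [ (p *ℚ ½ , M₂) ]) i)
      ≡⟨ cong (massAt k) (iterate-stepD-++ i _ _) ⟩
    massAt k (iterate stepD [ (p *ℚ ½ , M₁) ] i ++ iterate stepD [ (p *ℚ ½ , M₂) ] i)
      ≡⟨ massAt-++ k (iterate stepD [ (p *ℚ ½ , M₁) ] i) _ ⟩
    massAt k (iterate stepD [ (p *ℚ ½ , M₁) ] i) +ℚ massAt k (iterate stepD [ (p *ℚ ½ , M₂) ] i)
      ≡⟨ cong₂ _+ℚ_ (h₁ i (ℕ.≤-trans (ℕ.m≤m⊔n N₁ N₂) N≤i)) (h₂ i (ℕ.≤-trans (ℕ.m≤n⊔m N₁ N₂) N≤i)) ⟩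
    p *ℚ ½ *ℚ mass k t₁ +ℚ p *ℚ ½ *ℚ mass k t₂
      ≡⟨ cong₂ _+ℚ_ (ℚ.*-assoc p ½ (mass k t₁)) (ℚ.*-assoc p ½ (mass k t₂)) ⟩
    p *ℚ (½ *ℚ mass k t₁) +ℚ p *ℚ (½ *ℚ mass k t₂)
      ≡⟨ sym (ℚ.*-distribˡ-+ p _ _) ⟩
    p *ℚ mass k (node t₁ t₂) ∎ }
  where open ≡-Reasoning

eventually-constant⇒⟶ : ∀ (s : ℕ → ℚ) q N → (∀ i → N ≤ i → s i ≡ q) → s ⟶ q
eventually-constant⇒⟶ s q N h ε ε>0 = N , λ i N≤i →
  Eq.subst (λ x → ∣ x - q ∣ < ε) (sym (h i N≤i)) (Eq.subst (λ x → ∣ x ∣ < ε) (sym (ℚ.+-inverseʳ q)) ε>0)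

follows⇒⟦⟧ : ∀ k {M : Tm [] nat} {t} → Follows Prob._≈_ M t → ⟦ M ⟧at k ≡ mass k t
follows⇒⟦⟧ k {M} {t} f with massAt-follows k f 1ℚ
... | N , h = eventually-constant⇒⟶ _ _ N λ i N≤i →
  trans (cong (massAt k) (iterD≡iterate i M)) (trans (h i N≤i) (ℚ.*-identityˡ (mass k t)))

#0 : ∀ {Γ A} → Tm (A ∷ Γ) A
#0 = var here
#1 : ∀ {Γ A B} → Tm (B ∷ A ∷ Γ) A
#1 = var (there here)
#2 : ∀ {Γ A B C} → Tm (C ∷ B ∷ A ∷ Γ) A
#2 = var (there (there here))
#3 : ∀ {Γ A B C D} → Tm (D ∷ C ∷ B ∷ A ∷ Γ) A
#3 = var (there (there (there here)))

plusᵀ : ∀ {Γ} → Tm Γ (nat ⇒ nat ⇒ nat)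
plusᵀ = lam (lam (rec #1 (lam (lam (sucₜ #0))) #0))

doubleᵀ : ∀ {Γ} → Tm Γ (nat ⇒ nat)
doubleᵀ = lam (rec zeroₜ (lam (lam (sucₜ (sucₜ #0)))) #0)

-- s ↦ (⌊s/2⌋ , s mod 2)
halveᵀ : ∀ {Γ} → Tm Γ (nat ⇒ nat ⊗ nat)
halveᵀ = lam (rec (pair zeroₜ zeroₜ)
  (lam (lam (rec (pair (fst #0) (sucₜ zeroₜ)) (lam (lam (pair (sucₜ (fst #2)) zeroₜ))) (snd #0)))) #0)

-- d h ↦ Σ_{s < 2^d} h s, splitting on the lowest bit of s
sumᵀ : ∀ {Γ} → Tm Γ (nat ⇒ (nat ⇒ nat) ⇒ nat)
sumᵀ = lam (rec (lam (app #0 zeroₜ))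
  (lam (lam (lam (app (app plusᵀ (app #1 (lam (app #1 (app doubleᵀ #0)))))
                                  (app #1 (lam (app #1 (sucₜ (app doubleᵀ #0))))))))) #0)

eqᵀ : ∀ {Γ} → Tm Γ (nat ⇒ nat ⇒ nat)
eqᵀ = lam (rec (lam (rec (sucₜ zeroₜ) (lam (lam zeroₜ)) #0))
  (lam (lam (lam (rec zeroₜ (lam (lam (app #3 #1))) #0)))) #0)

countᵀ : ∀ {Γ} → Tm Γ (nat ⇒ (nat ⇒ nat) ⇒ nat ⇒ nat)
countᵀ = lam (lam (lam (app (app sumᵀ #2) (lam (app (app eqᵀ (app #2 #0)) #1)))))

-- A sampler ⟨d , f⟩ consumes at most d coins: f maps a coin sequence, read lowest bit
-- first, to a result and the unused coins.
Sampler : Ty → Ty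
Sampler X = nat ⊗ (nat ⇒ X ⊗ nat)

returnˢ : ∀ {Γ X} → Tm Γ (X ⇒ Sampler X)
returnˢ = lam (pair zeroₜ (lam (pair #1 #0)))

-- The depth of m >>= k is d + Σ_{s < 2^d} (depth of k at the result of s): crude, but T-definable.
bindˢ : ∀ {Γ X Y} → Tm Γ (Sampler X ⇒ (X ⇒ Sampler Y) ⇒ Sampler Y)
bindˢ = lam (lam (pair
  (app (app plusᵀ (fst #1)) (app (app sumᵀ (fst #1)) (lam (fst (app #1 (fst (app (snd #2) #0)))))))
  (lam (app (snd (app #1 (fst (app (snd #2) #0)))) (snd (app (snd #2) #0))))))

chooseˢ : ∀ {Γ X} → Tm Γ (Sampler X ⇒ Sampler X ⇒ Sampler X)
chooseˢ = lam (lam (pair (sucₜ (app (app plusᵀ (fst #1)) (fst #0)))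
  (lam (rec (app (snd #2) (fst (app halveᵀ #0))) (lam (lam (app (snd #3) (fst (app halveᵀ #2)))))
            (snd (app halveᵀ #0))))))

appˢ : ∀ {Γ X Y} → Tm Γ (Sampler (X ⇒ Sampler Y) ⇒ Sampler X ⇒ Sampler Y)
appˢ = lam (lam (app (app bindˢ #1) (lam (app (app bindˢ #1) (lam (app #1 #0))))))

mapˢ : ∀ {Γ X Y} → Tm (X ∷ Γ) Y → Tm Γ (Sampler X ⇒ Sampler Y)
mapˢ M = lam (app (app bindˢ #0) (lam (app returnˢ (rename (ext there) M))))

pairˢ : ∀ {Γ X Y} → Tm Γ (Sampler X ⇒ Sampler Y ⇒ Sampler (X ⊗ Y))
pairˢ = lam (lam (app (app bindˢ #1) (lam (app (app bindˢ #1) (lam (app returnˢ (pair #1 #0)))))))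

recˢ : ∀ {Γ X} → Tm Γ (Sampler X ⇒ Sampler (nat ⇒ Sampler (X ⇒ Sampler X)) ⇒ Sampler nat ⇒ Sampler X)
recˢ = lam (lam (lam (app (app bindˢ #2) (lam (app (app bindˢ #2) (lam (app (app bindˢ #2) (lam
  (rec (app returnˢ #2)
       (lam (lam (app (app bindˢ (app #3 #1)) (lam (app (app bindˢ #1) (lam (app #1 #0)))))))
       #0)))))))))

trTy : Ty → Ty
trTy nat     = nat
trTy (A ⇒ B) = trTy A ⇒ Sampler (trTy B)
trTy (A ⊗ B) = trTy A ⊗ trTy B

trVar : ∀ {Γ A} → Γ ∋ A → map trTy Γ ∋ trTy A
trVar here      = here
trVar (there x) = there (trVar x)

⌈_⌉ : ∀ {Γ A} → Tm Γ A → Tm (map trTy Γ) (Sampler (trTy A))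
⌈ var x ⌉     = app returnˢ (var (trVar x))
⌈ lam M ⌉     = app returnˢ (lam ⌈ M ⌉)
⌈ app M N ⌉   = app (app appˢ ⌈ M ⌉) ⌈ N ⌉
⌈ zeroₜ ⌉     = app returnˢ zeroₜ
⌈ sucₜ M ⌉    = app (mapˢ (sucₜ #0)) ⌈ M ⌉
⌈ pair M N ⌉  = app (app pairˢ ⌈ M ⌉) ⌈ N ⌉
⌈ fst M ⌉     = app (mapˢ (fst #0)) ⌈ M ⌉
⌈ snd M ⌉     = app (mapˢ (snd #0)) ⌈ M ⌉
⌈ rec M N P ⌉ = app (app (app recˢ ⌈ M ⌉) ⌈ N ⌉) ⌈ P ⌉
⌈ M ⊕ N ⌉     = app (app chooseˢ ⌈ M ⌉) ⌈ N ⌉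

-- The combinators are concrete ⊕-free terms: their Det proofs are solved by η for ⊤.
Det-⌈⌉ : ∀ {Γ A} (M : Tm Γ A) → Det ⌈ M ⌉
Det-⌈⌉ (var x)     = _
Det-⌈⌉ (lam M)     = _ , Det-⌈⌉ M
Det-⌈⌉ (app M N)   = (_ , Det-⌈⌉ M) , Det-⌈⌉ N
Det-⌈⌉ zeroₜ       = _
Det-⌈⌉ (sucₜ M)    = _ , Det-⌈⌉ M
Det-⌈⌉ (pair M N)  = (_ , Det-⌈⌉ M) , Det-⌈⌉ N
Det-⌈⌉ (fst M)     = _ , Det-⌈⌉ M
Det-⌈⌉ (snd M)     = _ , Det-⌈⌉ M
Det-⌈⌉ (rec M N P) = ((_ , Det-⌈⌉ M) , Det-⌈⌉ N) , Det-⌈⌉ P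
Det-⌈⌉ (M ⊕ N)     = (_ , Det-⌈⌉ M) , Det-⌈⌉ N

-- ⟨d , f⟩ k ↦ ⟨#{s < 2^d | f s yields k} , d⟩
probabilityᵀ : ∀ {Γ} → Tm Γ (Sampler nat ⇒ nat ⇒ BIN)
probabilityᵀ = lam (lam (pair (app (app (app countᵀ (fst #1)) (lam (fst (app (snd #2) #0)))) #0) (fst #1)))

supportBoundᵀ : ∀ {Γ} → Tm Γ (Sampler nat ⇒ nat)
supportBoundᵀ = lam (sucₜ (app (app sumᵀ (fst #0)) (lam (fst (app (snd #1) #0)))))

open Pure using (recSem) renaming (Sem to Val)

-- Written with recSem so that they are definitionally the denotations of the terms above.
plus : ℕ → ℕ → ℕ
plus a = recSem a (λ _ r → suc r)

double : ℕ → ℕ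
double = recSem 0 (λ _ r → suc (suc r))

halve : ℕ → ℕ × ℕ
halve = recSem (0 , 0) (λ _ r → recSem (proj₁ r , 1) (λ _ _ → suc (proj₁ r) , 0) (proj₂ r))

sum2^ : ℕ → (ℕ → ℕ) → ℕ
sum2^ = recSem (λ h → h 0) (λ _ r h → plus (r (λ s → h (double s))) (r (λ s → h (suc (double s)))))

eq : ℕ → ℕ → ℕ
eq = recSem (recSem 1 (λ _ _ → 0)) (λ _ r → recSem 0 (λ b _ → r b))

count2^ : ℕ → (ℕ → ℕ) → ℕ → ℕ
count2^ d h k = sum2^ d (λ s → eq (h s) k)

SamplerVal : Set → Set
SamplerVal X = ℕ × (ℕ → X × ℕ)

returnᴾ : ∀ {X : Set} → X → SamplerVal X
returnᴾ x = 0 , λ s → x , s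

bindᴾ : ∀ {X Y : Set} → SamplerVal X → (X → SamplerVal Y) → SamplerVal Y
bindᴾ (d , f) k = plus d (sum2^ d λ s → proj₁ (k (proj₁ (f s)))) ,
                  λ s → proj₂ (k (proj₁ (f s))) (proj₂ (f s))

chooseᴾ : ∀ {X : Set} → SamplerVal X → SamplerVal X → SamplerVal X
chooseᴾ (d₁ , f₁) (d₂ , f₂) = suc (plus d₁ d₂) ,
  λ s → recSem (f₁ (proj₁ (halve s))) (λ _ _ → f₂ (proj₁ (halve s))) (proj₂ (halve s))

recᴾ : ∀ {X : Set} → X → (ℕ → SamplerVal (X → SamplerVal X)) → ℕ → SamplerVal X
recᴾ z s = recSem (returnᴾ z) (λ n r → bindᴾ (s n) λ g → bindᴾ r g)

plus≡+ : ∀ a b → plus a b ≡ a + b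
plus≡+ a zero    = sym (ℕ.+-identityʳ a)
plus≡+ a (suc b) = trans (cong suc (plus≡+ a b)) (sym (ℕ.+-suc a b))

m≤plus : ∀ a b → a ≤ plus a b
m≤plus a b rewrite plus≡+ a b = ℕ.m≤m+n a b

n≤plus : ∀ a b → b ≤ plus a b
n≤plus a b rewrite plus≡+ a b = ℕ.m≤n+m b a

h0≤sum2^ : ∀ d h → h 0 ≤ sum2^ d h
h0≤sum2^ zero    h = ℕ.≤-refl
h0≤sum2^ (suc d) h =
  ℕ.≤-trans (h0≤sum2^ d (λ s → h (double s))) (m≤plus _ (sum2^ d (λ s → h (suc (double s)))))

mutual
  halve-double : ∀ s → halve (double s) ≡ (s , 0)
  halve-double zero = refl
  halve-double (suc s) rewrite halve-1+double s = refl

  halve-1+double : ∀ s → halve (suc (double s)) ≡ (s , 1)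
  halve-1+double s rewrite halve-double s = refl

-- At a node of t the lowest coin selects the subtree and is consumed; at a leaf none is.
mutual
  Matches : ∀ A → Prob.Sem A → Val (trTy A) → Set
  Matches nat     m n = m ≡ n
  Matches (A ⇒ B) f g = ∀ v w → Matches A v w → Realises B (f v) (g w)
  Matches (A ⊗ B) p q = Matches A (proj₁ p) (proj₁ q) × Matches B (proj₂ p) (proj₂ q)

  Samples : ∀ A → Tree (Prob.Sem A) → ℕ → (ℕ → Val (trTy A) × ℕ) → Set
  Samples A (leaf v)   d       f = Σ (Val (trTy A)) λ w → Matches A v w × (∀ s → f s ≡ (w , s))
  Samples A (node t u) zero    f = ⊥
  Samples A (node t u) (suc d) f = Samples A t d (λ s → f (double s)) × Samples A u d (λ s → f (suc (double s)))

  Realises : ∀ A → Tree (Prob.Sem A) → SamplerVal (Val (trTy A)) → Set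
  Realises A t (d , f) = Samples A t d f

samples-ext : ∀ A t d {f g} → (∀ s → f s ≡ g s) → Samples A t d f → Samples A t d g
samples-ext A (leaf v)   d       f≗g (w , m , h) = w , m , λ s → trans (sym (f≗g s)) (h s)
samples-ext A (node t u) (suc d) f≗g (h₁ , h₂) =
  samples-ext A t d (λ s → f≗g (double s)) h₁ , samples-ext A u d (λ s → f≗g (suc (double s))) h₂

samples-mono : ∀ A t {d d′ f} → d ≤ d′ → Samples A t d f → Samples A t d′ f
samples-mono A (leaf v)   d≤d′       h         = h
samples-mono A (node t u) (s≤s d≤d′) (h₁ , h₂) = samples-mono A t d≤d′ h₁ , samples-mono A u d≤d′ h₂

realises-return : ∀ A {v w} → Matches A v w → Realises A (leaf v) (returnᴾ w)
realises-return A m = _ , m , λ s → refl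

samples-bind : ∀ A B t d f {G : Prob.Sem A → Tree (Prob.Sem B)} {g : Val (trTy A) → SamplerVal (Val (trTy B))} e →
  Samples A t d f → (∀ v w → Matches A v w → Realises B (G v) (g w)) →
  sum2^ d (λ s → proj₁ (g (proj₁ (f s)))) ≤ e →
  Samples B (t >>=ᵗ G) (d + e) (λ s → proj₂ (g (proj₁ (f s))) (proj₂ (f s)))
samples-bind A B (leaf v) d f {G} {g} e (w , m , h) k sum≤e =
  samples-ext B (G v) (d + e) (λ s → sym (cong (λ r → proj₂ (g (proj₁ r)) (proj₂ r)) (h s)))
    (samples-mono B (G v) depth-bound (k v w m))
  where
  depth-bound : proj₁ (g w) ≤ d + e
  depth-bound = begin
    proj₁ (g w)                               ≡⟨ cong (λ r → proj₁ (g (proj₁ r))) (h 0) ⟨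
    proj₁ (g (proj₁ (f 0)))                   ≤⟨ h0≤sum2^ d _ ⟩
    sum2^ d (λ s → proj₁ (g (proj₁ (f s))))   ≤⟨ sum≤e ⟩
    e                                         ≤⟨ ℕ.m≤n+m e d ⟩
    d + e                                     ∎
    where open ℕ.≤-Reasoning
samples-bind A B (node t u) (suc d) f {g = g} e (h₁ , h₂) k sum≤e =
  samples-bind A B t d _ e h₁ k (ℕ.≤-trans (m≤plus _ (sum2^ d (λ s → proj₁ (g (proj₁ (f (suc (double s)))))))) sum≤e) ,
  samples-bind A B u d _ e h₂ k (ℕ.≤-trans (n≤plus (sum2^ d (λ s → proj₁ (g (proj₁ (f (double s)))))) _) sum≤e)

realises-bind : ∀ A B {t m} {G : Prob.Sem A → Tree (Prob.Sem B)} {g : Val (trTy A) → SamplerVal (Val (trTy B))} →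
  Realises A t m → (∀ v w → Matches A v w → Realises B (G v) (g w)) → Realises B (t >>=ᵗ G) (bindᴾ m g)
realises-bind A B {t} {d , f} {G} {g} h k =
  Eq.subst (λ d′ → Samples B (t >>=ᵗ G) d′ (λ s → proj₂ (g (proj₁ (f s))) (proj₂ (f s))))
    (sym (plus≡+ d _)) (samples-bind A B t d f _ h k ℕ.≤-refl)

realises-choose : ∀ A {t u m₁ m₂} → Realises A t m₁ → Realises A u m₂ → Realises A (node t u) (chooseᴾ m₁ m₂)
realises-choose A {t} {u} {d₁ , f₁} {d₂ , f₂} h₁ h₂ =
  samples-mono A t (m≤plus d₁ d₂) (samples-ext A t d₁ (λ s → sym (cong select (halve-double s))) h₁) ,
  samples-mono A u (n≤plus d₁ d₂) (samples-ext A u d₂ (λ s → sym (cong select (halve-1+double s))) h₂)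
  where
  select : ℕ × ℕ → Val (trTy A) × ℕ
  select (s , b) = recSem (f₁ s) (λ _ _ → f₂ s) b

realises-rec : ∀ A {z z′ s s′} → Matches A z z′ → Matches (nat ⇒ A ⇒ A) s s′ → ∀ n →
  Realises A (Prob.recSem z s n) (recᴾ z′ s′ n)
realises-rec A mz ms zero    = realises-return A mz
realises-rec A mz ms (suc n) =
  realises-bind (A ⇒ A) A (ms n n refl) λ g g′ mg → realises-bind A A (realises-rec A mz ms n) mg

MatchesEnv : ∀ {Γ} → Prob.Env Γ → Pure.Env (map trTy Γ) → Set
MatchesEnv {Γ} γ δ = ∀ {A} (x : Γ ∋ A) → Matches A (γ x) (δ (trVar x))

realises-⌈⌉ : ∀ {Γ A} (M : Tm Γ A) (γ : Prob.Env Γ) (δ : Pure.Env (map trTy Γ)) → MatchesEnv γ δ →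
  Realises A (Prob.eval M γ) (Pure.eval ⌈ M ⌉ δ)
realises-⌈⌉ {A = A} (var x) γ δ m = realises-return A (m x)
realises-⌈⌉ {A = A ⇒ B} (lam M) γ δ m = realises-return (A ⇒ B) λ v w mvw →
  realises-⌈⌉ M (v Prob.∷ᵉ γ) (w Pure.∷ᵉ δ) λ { here → mvw ; (there x) → m x }
realises-⌈⌉ {A = B} (app {A = A} M N) γ δ m =
  realises-bind (A ⇒ B) B (realises-⌈⌉ M γ δ m) λ f g mfg →
  realises-bind A B (realises-⌈⌉ N γ δ m) mfg
realises-⌈⌉ zeroₜ γ δ m = realises-return nat refl
realises-⌈⌉ (sucₜ M) γ δ m =
  realises-bind nat nat (realises-⌈⌉ M γ δ m) λ v w e → realises-return nat (cong suc e)
realises-⌈⌉ (pair {A = A} {B} M N) γ δ m =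
  realises-bind A (A ⊗ B) (realises-⌈⌉ M γ δ m) λ a a′ m₁ →
  realises-bind B (A ⊗ B) (realises-⌈⌉ N γ δ m) λ b b′ m₂ → realises-return (A ⊗ B) (m₁ , m₂)
realises-⌈⌉ (fst {A = A} {B} M) γ δ m =
  realises-bind (A ⊗ B) A (realises-⌈⌉ M γ δ m) λ p q mpq → realises-return A (proj₁ mpq)
realises-⌈⌉ (snd {A = A} {B} M) γ δ m =
  realises-bind (A ⊗ B) B (realises-⌈⌉ M γ δ m) λ p q mpq → realises-return B (proj₂ mpq)
realises-⌈⌉ {A = A} (rec M N P) γ δ m =
  realises-bind A A (realises-⌈⌉ M γ δ m) λ z z′ mz →
  realises-bind (nat ⇒ A ⇒ A) A (realises-⌈⌉ N γ δ m) λ s s′ ms →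
  realises-bind nat A (realises-⌈⌉ P γ δ m) λ { n .n refl → realises-rec A mz ms n }
realises-⌈⌉ {A = A} (M ⊕ N) γ δ m = realises-choose A (realises-⌈⌉ M γ δ m) (realises-⌈⌉ N γ δ m)

eq-refl : ∀ a → eq a a ≡ 1
eq-refl zero    = refl
eq-refl (suc a) = eq-refl a

eq-≢ : ∀ a b → ¬ a ≡ b → eq a b ≡ 0
eq-≢ zero    zero    a≢b = ⊥-elim (a≢b refl)
eq-≢ zero    (suc b) a≢b = refl
eq-≢ (suc a) zero    a≢b = refl
eq-≢ (suc a) (suc b) a≢b = eq-≢ a b λ a≡b → a≢b (cong suc a≡b)

sum2^-const : ∀ d h c → (∀ s → h s ≡ c) → sum2^ d h ≡ 2 ^ d ℕ.* c
sum2^-const zero    h c h≗c = trans (h≗c 0) (sym (ℕ.+-identityʳ c))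
sum2^-const (suc d) h c h≗c = begin
  plus (sum2^ d _) (sum2^ d _)   ≡⟨ cong₂ plus (sum2^-const d _ c λ s → h≗c _) (sum2^-const d _ c λ s → h≗c _) ⟩
  plus (2 ^ d ℕ.* c) (2 ^ d ℕ.* c) ≡⟨ plus≡+ (2 ^ d ℕ.* c) (2 ^ d ℕ.* c) ⟩
  2 ^ d ℕ.* c + 2 ^ d ℕ.* c       ≡⟨ sym (ℕ.*-distribʳ-+ c (2 ^ d) (2 ^ d)) ⟩
  (2 ^ d + 2 ^ d) ℕ.* c           ≡⟨ cong (λ x → (2 ^ d + x) ℕ.* c) (sym (ℕ.+-identityʳ (2 ^ d))) ⟩
  2 ^ suc d ℕ.* c                 ∎
  where open ≡-Reasoning

count2^-above-sum : ∀ d h k → sum2^ d h ℕ.< k → count2^ d h k ≡ 0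
count2^-above-sum zero    h k sum<k = eq-≢ (h 0) k λ h0≡k → ℕ.<-irrefl h0≡k sum<k
count2^-above-sum (suc d) h k sum<k
  rewrite count2^-above-sum d (λ s → h (double s)) k (ℕ.≤-<-trans (m≤plus _ (sum2^ d (λ s → h (suc (double s))))) sum<k)
        | count2^-above-sum d (λ s → h (suc (double s))) k (ℕ.≤-<-trans (n≤plus (sum2^ d (λ s → h (double s))) _) sum<k)
  = refl

mass≡dyadic-count : ∀ k t d f → Samples nat t d f → mass k t ≡ dyadic (count2^ d (λ s → proj₁ (f s)) k) d
mass≡dyadic-count k (leaf v) d f (.v , refl , h) with v ≟ k
... | yes refl = sym (begin
  dyadic (count2^ d (λ s → proj₁ (f s)) v) d ≡⟨ cong (λ c → dyadic c d) (sum2^-const d _ 1 λ s → trans (cong (λ r → eq (proj₁ r) v) (h s)) (eq-refl v)) ⟩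
  dyadic (2 ^ d ℕ.* 1) d                      ≡⟨ cong (λ c → dyadic c d) (ℕ.*-identityʳ (2 ^ d)) ⟩
  dyadic (2 ^ d) d                            ≡⟨ dyadic-2^ d ⟩
  1ℚ                                          ∎)
  where open ≡-Reasoning
... | no v≢k = sym (begin
  dyadic (count2^ d (λ s → proj₁ (f s)) k) d ≡⟨ cong (λ c → dyadic c d) (sum2^-const d _ 0 λ s → trans (cong (λ r → eq (proj₁ r) k) (h s)) (eq-≢ v k v≢k)) ⟩
  dyadic (2 ^ d ℕ.* 0) d                      ≡⟨ cong (λ c → dyadic c d) (ℕ.*-zeroʳ (2 ^ d)) ⟩
  dyadic 0 d                                  ≡⟨ dyadic-zero d ⟩
  0ℚ                                          ∎)
  where open ≡-Reasoning
mass≡dyadic-count k (node t u) (suc d) f (h₁ , h₂) = begin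
  ½ *ℚ mass k t +ℚ ½ *ℚ mass k u          ≡⟨ cong₂ (λ a b → ½ *ℚ a +ℚ ½ *ℚ b) (mass≡dyadic-count k t d _ h₁) (mass≡dyadic-count k u d _ h₂) ⟩
  ½ *ℚ dyadic c₁ d +ℚ ½ *ℚ dyadic c₂ d    ≡⟨ sym (ℚ.*-distribˡ-+ ½ (dyadic c₁ d) (dyadic c₂ d)) ⟩
  ½ *ℚ (dyadic c₁ d +ℚ dyadic c₂ d)       ≡⟨ cong (½ *ℚ_) (sym (dyadic-+ c₁ c₂ d)) ⟩
  ½ *ℚ dyadic (c₁ + c₂) d                 ≡⟨ cong (λ c → ½ *ℚ dyadic c d) (sym (plus≡+ c₁ c₂)) ⟩
  dyadic (plus c₁ c₂) (suc d)             ∎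
  where
  open ≡-Reasoning
  c₁ c₂ : ℕ
  c₁ = count2^ d (λ s → proj₁ (f (double s))) k
  c₂ = count2^ d (λ s → proj₁ (f (suc (double s)))) k

Pure-eval-num : ∀ {Γ} n (δ : Pure.Env Γ) → Pure.eval (num n) δ ≡ n
Pure-eval-num zero    δ = refl
Pure-eval-num (suc n) δ = cong suc (Pure-eval-num n δ)

Det-num : ∀ {Γ} n → Det {Γ} (num n)
Det-num zero    = tt
Det-num (suc n) = Det-num n

normalises-app-num : ∀ {B} (T : Tm [] (nat ⇒ B)) → Det T → ∀ n →
  Normalises Pure._≈_ (app T (num n)) (Pure.eval T Pure.∅ᵉ n)
normalises-app-num T d n =
  Eq.subst (λ m → Normalises Pure._≈_ (app T (num n)) (Pure.eval T Pure.∅ᵉ m)) (Pure-eval-num n Pure.∅ᵉ)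
    (Pure.adequacy-closed (app T (num n)) (Det⇒Admits (app T (num n)) (d , Det-num n)))

normalises-app-num₂ : ∀ {B} (T : Tm [] (nat ⇒ nat ⇒ B)) → Det T → ∀ n k →
  Normalises Pure._≈_ (app (app T (num n)) (num k)) (Pure.eval T Pure.∅ᵉ n k)
normalises-app-num₂ T d n k =
  Eq.subst (λ m → Normalises Pure._≈_ (app (app T (num n)) (num k)) (Pure.eval T Pure.∅ᵉ m k)) (Pure-eval-num n Pure.∅ᵉ)
    (normalises-app-num (app T (num n)) (d , Det-num n) k)

NF-nat : ∀ {T : Tm [] nat} {n} → Normalises Pure._≈_ T n → NF T ≡ num n
NF-nat {n = n} (_ , r , refl) = r , num-value n

NF-bin : ∀ {T : Tm [] BIN} {m e} → Normalises Pure._≈_ T (m , e) → NF T ≡ pair (num m) (num e)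
NF-bin {m = m} {e} (_ , r , _ , _ , refl , refl , refl) = r , vpair (num-value m) (num-value e)

module Witnesses (M : Tm [] (nat ⇒ nat)) where
  M[x] : Tm (nat ∷ []) nat
  M[x] = app (rename (λ ()) M) #0

  F : Tm [] (nat ⇒ nat ⇒ BIN)
  F = lam (app probabilityᵀ ⌈ M[x] ⌉)

  Q : Tm [] (nat ⇒ nat)
  Q = lam (app supportBoundᵀ ⌈ M[x] ⌉)

  Det-F : Det F
  Det-F = _ , Det-⌈⌉ M[x]

  Det-Q : Det Q
  Det-Q = _ , Det-⌈⌉ M[x]

  sampler : ℕ → SamplerVal ℕ
  sampler n = Pure.eval ⌈ M[x] ⌉ (n Pure.∷ᵉ Pure.∅ᵉ)

  depth : ℕ → ℕ
  depth n = proj₁ (sampler n)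

  outcome : ℕ → ℕ → ℕ
  outcome n s = proj₁ (proj₂ (sampler n) s)

  tree : ℕ → Tree ℕ
  tree n = Prob.eval M[x] (n Prob.∷ᵉ Prob.∅ᵉ)

  sampler-realises-tree : ∀ n → Realises nat (tree n) (sampler n)
  sampler-realises-tree n = realises-⌈⌉ M[x] _ _ λ { here → refl }

  M-follows-tree : ∀ n → Follows Prob._≈_ (app M (num n)) (tree n)
  M-follows-tree n = Eq.subst (λ T → Follows Prob._≈_ T (tree n))
    (cong (λ T → app T (num n)) (trans (subst-rename _ _ M) (subst-closed _ M)))
    (Prob.adequacy M[x] (admits-⊤ M[x]) ((λ ()) ,ₛ num n) (n Prob.∷ᵉ Prob.∅ᵉ) λ { here → refl })

mainTheorem16 : (M : Tm [] (nat ⇒ nat)) →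
  ∃[ F ] ∃[ Q ] (Det {[]} {nat ⇒ nat ⇒ BIN} F × Det {[]} {nat ⇒ nat} Q ×
    (∀ (n : ℕ) → ∃[ q ] ((NF app Q (num n) ≡ num q) ×
      (∀ (k : ℕ) → ∃[ m ] ∃[ e ]
        ((NF app (app F (num n)) (num k) ≡ pair (num m) (num e))
         × (⟦ app M (num n) ⟧at k ≡ dyadic m e)
         × (q ≤ k → m ≡ 0))))))
mainTheorem16 M = F , Q , Det-F , Det-Q , λ n →
  suc (sum2^ (depth n) (outcome n)) , NF-nat (normalises-app-num Q Det-Q n) , λ k →
  count2^ (depth n) (outcome n) k , depth n ,
  NF-bin (normalises-app-num₂ F Det-F n k) ,
  Eq.subst (λ p → ⟦ app M (num n) ⟧at k ≡ p)
    (mass≡dyadic-count k (tree n) (depth n) (proj₂ (sampler n)) (sampler-realises-tree n))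
    (follows⇒⟦⟧ k (M-follows-tree n)) ,
  count2^-above-sum (depth n) (outcome n) k
  where open Witnesses M
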